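{- Let $P(X)=X^4+c_3X^3+c_2X^2+c_1X+c_0\in\mathbb{Z}[X]$ be monic and irreducible, with root $r_1$. Let $a_0,a_1,a_2,a_3$ be indeterminates, $\alpha=a_0+a_1r_1+a_2r_1^2+a_3r_1^3$, and let $M_\alpha$ be the $4\times4$ matrix of the map $x\mapsto\alpha x$ on $\mathbb{Q}(r_1)$ in the basis $1,r_1,r_1^2,r_1^3$ (the $j$-th column being the coordinates of $\alpha r_1^{j-1}$), so that its entries lie in $\mathbb{Z}[a_0,a_1,a_2,a_3]$. Let $N_P(\alpha)=\det M_\alpha$ and let $B_{ij}\in\mathbb{Z}[a_0,a_1,a_2,a_3]$ be the cofactor $(-1)^{i+j}$ times the determinant of the $3\times3$ matrix obtained from $M_\alpha$ by deleting row $i$ and column $j$. Then there is a homogeneous polynomial $q_3=q_3(a_1,a_2,a_3)$, not depending on $a_0$, such that \[ B_{24}B_{13}-B_{14}B_{23}=q_3\,N_P(\alpha) \] as polynomials. -}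

module Defs where

open import Data.Nat using (ℕ; zero; suc; _≥_)
open import Data.Integer using (ℤ; _+_; _*_; -_; _-_; 0ℤ; 1ℤ)
open import Data.Fin using (Fin; zero; suc; fromℕ; toℕ; punchIn)
open import Data.List using (List; []; _∷_)
open import Data.List.Relation.Unary.All using (All)
open import Data.Product using (_×_; Σ; ∃)
open import Data.Sum using (_⊎_)
open import Relation.Binary.PropositionalEquality using (_≡_; _≢_)
open import Relation.Nullary using (¬_)

_^ℤ_ : ℤ → ℕ → ℤ
x ^ℤ zero  = 1ℤ
x ^ℤ suc n = x * (x ^ℤ n)

sign : ℕ → ℤ
sign zero          = 1ℤ
sign (suc zero)    = - 1ℤ
sign (suc (suc k)) = sign k

sumFin : ∀ {n} → (Fin n → ℤ) → ℤ
sumFin {zero}  f = 0ℤ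
sumFin {suc n} f = f zero + sumFin (λ i → f (suc i))

record ℤPoly : Set where
  constructor poly
  field
    deg   : ℕ
    coeff : Fin (suc deg) → ℤ
open ℤPoly public

leading : ℤPoly → ℤ
leading (poly d c) = c (fromℕ d)

evalPoly : ℤPoly → ℤ → ℤ
evalPoly (poly d c) x = sumFin (λ i → c i * (x ^ℤ toℕ i))

quartic : ℤ → ℤ → ℤ → ℤ → ℤPoly
quartic c3 c2 c1 c0 = poly 4 q
  where
  q : Fin 5 → ℤ
  q zero                         = c0
  q (suc zero)                   = c1
  q (suc (suc zero))             = c2
  q (suc (suc (suc zero)))       = c3
  q (suc (suc (suc (suc zero)))) = 1ℤ

-- Irreducible in ℤ[X] (for a monic, hence primitive, polynomial):
-- not a product of two non-constant polynomials of ℤ[X].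
-- (Polynomial equality over ℤ is tested pointwise on ℤ, which is
-- equivalent since ℤ is an infinite integral domain.)
Irreducible : ℤPoly → Set
Irreducible P =
  ∀ (F G : ℤPoly) → leading F ≢ 0ℤ → leading G ≢ 0ℤ →
  deg F ≥ 1 → deg G ≥ 1 →
  ¬ (∀ x → evalPoly F x * evalPoly G x ≡ evalPoly P x)

-- Arithmetic in Q(r1) = Q[X]/(P) in the basis 1, r1, r1^2, r1^3.
-- Coordinate vectors are functions Fin 4 → ℤ.

Coords : Set
Coords = Fin 4 → ℤ

i0 i1 i2 i3 : Fin 4
i0 = zero
i1 = suc zero
i2 = suc (suc zero)
i3 = suc (suc (suc zero))

-- coordinates of r1 · x, using r1^4 = - c3 r1^3 - c2 r1^2 - c1 r1 - c0
mulR : ℤ → ℤ → ℤ → ℤ → Coords → Coords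
mulR c3 c2 c1 c0 x zero                   = - (c0 * x i3)
mulR c3 c2 c1 c0 x (suc zero)             = x i0 - c1 * x i3
mulR c3 c2 c1 c0 x (suc (suc zero))       = x i1 - c2 * x i3
mulR c3 c2 c1 c0 x (suc (suc (suc zero))) = x i2 - c3 * x i3

alphaTimesRPow : ℤ → ℤ → ℤ → ℤ → Coords → ℕ → Coords
alphaTimesRPow c3 c2 c1 c0 α zero    = α
alphaTimesRPow c3 c2 c1 c0 α (suc k) =
  mulR c3 c2 c1 c0 (alphaTimesRPow c3 c2 c1 c0 α k)

Matrix : ℕ → Set
Matrix n = Fin n → Fin n → ℤ

-- M_α (0-based indices): column j = coordinates of α r1^j,
-- where α = a0 + a1 r1 + a2 r1^2 + a3 r1^3.
Malpha : (c3 c2 c1 c0 a0 a1 a2 a3 : ℤ) → Matrix 4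
Malpha c3 c2 c1 c0 a0 a1 a2 a3 i j =
  alphaTimesRPow c3 c2 c1 c0 α (toℕ j) i
  where
  α : Coords
  α zero                   = a0
  α (suc zero)             = a1
  α (suc (suc zero))       = a2
  α (suc (suc (suc zero))) = a3

minor : ∀ {n} → Matrix (suc n) → Fin (suc n) → Fin (suc n) → Matrix n
minor M i j k l = M (punchIn i k) (punchIn j l)

det : ∀ {n} → Matrix n → ℤ
det {zero}  M = 1ℤ
det {suc n} M = sumFin (λ j → sign (toℕ j) * (M zero j * det (minor M zero j)))

cofactor : ∀ {n} → Matrix (suc n) → Fin (suc n) → Fin (suc n) → ℤ
cofactor M i j = sign (toℕ i Data.Nat.+ toℕ j) * det (minor M i j)

record Term3 : Set where
  constructor term
  field
    coef : ℤ
    e1 e2 e3 : ℕ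
open Term3 public

Poly3 : Set
Poly3 = List Term3

evalTerm3 : Term3 → ℤ → ℤ → ℤ → ℤ
evalTerm3 (term c k1 k2 k3) a1 a2 a3 = c * ((a1 ^ℤ k1) * ((a2 ^ℤ k2) * (a3 ^ℤ k3)))

evalPoly3 : Poly3 → ℤ → ℤ → ℤ → ℤ
evalPoly3 []      a1 a2 a3 = 0ℤ
evalPoly3 (t ∷ q) a1 a2 a3 = evalTerm3 t a1 a2 a3 + evalPoly3 q a1 a2 a3

HomogeneousOfDegree : ℕ → Poly3 → Set
HomogeneousOfDegree d q = All (λ t → e1 t Data.Nat.+ e2 t Data.Nat.+ e3 t ≡ d) q

{-# OPTIONS --safe #-}
module Submission where

-- The left-hand side is the 2×2 minor, on rows {0,1} and columns {2,3}, of the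
-- matrix of cofactors of M = M_α.  By Jacobi's complementary minor theorem it
-- equals det M times the complementary minor of M, on rows {2,3} and columns
-- {0,1}.  That block holds the r1², r1³ coordinates of α and α r1, namely
-- a2, a3 and a1 − c2 a3, a2 − c3 a3, so q3 = a2 (a2 − c3 a3) − a3 (a1 − c2 a3):
-- homogeneous of degree 2 and free of a0.  The identity holds for every monic
-- quartic.

open import Defs
open import Data.Nat using (ℕ; zero; suc)
open import Data.Integer using (ℤ; _*_; _-_; -_; 1ℤ; 0ℤ)
open import Data.Fin using (Fin; zero; suc; toℕ; punchIn; _↑ˡ_; _↑ʳ_; combine)
open import Data.Vec using (tabulate; concat)
open import Data.Product using (Σ; _×_; _,_)
open import Data.List using (_∷_; [])
open import Data.List.Relation.Unary.All using (_∷_; [])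
open import Function using (_∘_)
open import Relation.Binary.PropositionalEquality using (_≡_; refl; trans; cong)
open import Data.Integer.Solver using (module +-*-Solver)
open +-*-Solver

-- Copies of sumFin, det, cofactor and evalTerm3 as ring-solver syntax: their
-- denotations unfold definitionally to the originals, so identities between
-- determinants become goals for the solver.
module Expressions {k : ℕ} where

  MatrixExpr : ℕ → Set
  MatrixExpr n = Fin n → Fin n → Polynomial k

  sumFinExpr : ∀ {n} → (Fin n → Polynomial k) → Polynomial k
  sumFinExpr {zero}  f = con 0ℤ
  sumFinExpr {suc n} f = f zero :+ sumFinExpr (f ∘ suc)

  minorExpr : ∀ {n} → MatrixExpr (suc n) → Fin (suc n) → Fin (suc n) → MatrixExpr n
  minorExpr M i j k l = M (punchIn i k) (punchIn j l)

  detExpr : ∀ {n} → MatrixExpr n → Polynomial k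
  detExpr {zero}  M = con 1ℤ
  detExpr {suc n} M =
    sumFinExpr (λ j → con (sign (toℕ j)) :* (M zero j :* detExpr (minorExpr M zero j)))

  cofactorExpr : ∀ {n} → MatrixExpr (suc n) → Fin (suc n) → Fin (suc n) → Polynomial k
  cofactorExpr M i j = con (sign (toℕ i Data.Nat.+ toℕ j)) :* detExpr (minorExpr M i j)

  evalTerm3Expr : Polynomial k → ℕ → ℕ → ℕ →
                  Polynomial k → Polynomial k → Polynomial k → Polynomial k
  evalTerm3Expr c k1 k2 k3 a1 a2 a3 = c :* ((a1 :^ k1) :* ((a2 :^ k2) :* (a3 :^ k3)))

open Expressions

lowerLeftBlock : {A : Set} → (Fin 4 → Fin 4 → A) → Fin 2 → Fin 2 → A
lowerLeftBlock M k l = M (2 ↑ʳ k) (l ↑ˡ 2)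

jacobi-complementary-minor : (M : Matrix 4) →
  cofactor M i1 i3 * cofactor M i0 i2 - cofactor M i0 i3 * cofactor M i1 i2
    ≡ det (lowerLeftBlock M) * det M
jacobi-complementary-minor M =
  prove (concat (tabulate (tabulate ∘ M)))
    (cofactorExpr X i1 i3 :* cofactorExpr X i0 i2 :- cofactorExpr X i0 i3 :* cofactorExpr X i1 i2)
    (detExpr (lowerLeftBlock X) :* detExpr X)
    refl
  where
  -- entry (i , j) is variable 4 i + j, matching the row-major environment
  X : MatrixExpr 4
  X i j = var (combine i j)

q3 : ℤ → ℤ → Poly3
q3 c3 c2 = term 1ℤ 0 2 0 ∷ term (- c3) 0 1 1 ∷ term (- 1ℤ) 1 0 1 ∷ term c2 0 0 2 ∷ []

q3-homogeneous : ∀ c3 c2 → HomogeneousOfDegree 2 (q3 c3 c2)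
q3-homogeneous c3 c2 = refl ∷ refl ∷ refl ∷ refl ∷ []

det-lowerLeftBlock-Malpha : ∀ c3 c2 c1 c0 a0 a1 a2 a3 →
  det (lowerLeftBlock (Malpha c3 c2 c1 c0 a0 a1 a2 a3)) ≡ evalPoly3 (q3 c3 c2) a1 a2 a3
det-lowerLeftBlock-Malpha c3 c2 c1 c0 a0 = solve 5 (λ c3 c2 a1 a2 a3 →
  detExpr (lowerLeftBlockExpr c3 c2 a1 a2 a3)
  := evalTerm3Expr (con 1ℤ) 0 2 0 a1 a2 a3
     :+ (evalTerm3Expr (:- c3) 0 1 1 a1 a2 a3
     :+ (evalTerm3Expr (con (- 1ℤ)) 1 0 1 a1 a2 a3
     :+ (evalTerm3Expr c2 0 0 2 a1 a2 a3
     :+ con 0ℤ))))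
  refl c3 c2
  where
  lowerLeftBlockExpr : (c3 c2 a1 a2 a3 : Polynomial 5) → MatrixExpr 2
  lowerLeftBlockExpr c3 c2 a1 a2 a3 zero       zero       = a2
  lowerLeftBlockExpr c3 c2 a1 a2 a3 zero       (suc zero) = a1 :- c2 :* a3
  lowerLeftBlockExpr c3 c2 a1 a2 a3 (suc zero) zero       = a3
  lowerLeftBlockExpr c3 c2 a1 a2 a3 (suc zero) (suc zero) = a2 :- c3 :* a3

lemma5p3 : (c3 c2 c1 c0 : ℤ) → Irreducible (quartic c3 c2 c1 c0) →
    Σ Poly3 λ q3 → Σ ℕ λ d → HomogeneousOfDegree d q3 ×
      (∀ (a0 a1 a2 a3 : ℤ) →
        let M = Malpha c3 c2 c1 c0 a0 a1 a2 a3 in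
        cofactor M i1 i3 * cofactor M i0 i2 - cofactor M i0 i3 * cofactor M i1 i2
          ≡ evalPoly3 q3 a1 a2 a3 * det M)
lemma5p3 c3 c2 c1 c0 _ = q3 c3 c2 , 2 , q3-homogeneous c3 c2 , λ a0 a1 a2 a3 →
  let M = Malpha c3 c2 c1 c0 a0 a1 a2 a3 in
  trans (jacobi-complementary-minor M)
        (cong (_* det M) (det-lowerLeftBlock-Malpha c3 c2 c1 c0 a0 a1 a2 a3))
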